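{- Let $\mu,\lambda,\nu$ be partitions. Then the set $V=V(K_\mu\times K_\lambda;K_\nu^{w(\nu)})=\{(x,y)\in K_\mu\times K_\lambda: xy\in K_\nu^{w(\nu)}\}$ is a finite union of orbits of the reverted action of $B_\infty\times B_\infty$ on $S_{2\infty}\times S_{2\infty}$.
   Context: Partitions: $l(\mu)$ number of nonzero parts, $|\mu|$ sum of parts, $w(\mu)=l(\mu)+|\mu|$. $S_{2\infty}$ is the group of finitely supported permutations of the positive integers, $S_{2n}$ the permutations of $[2n]$, $B_n\subseteq S_{2n}$ the centralizer of $(1\,2)(3\,4)\cdots(2n-1\,2n)$, $B_\infty=\bigcup_nB_n$. The reverted action is $(a,b)\cdot_r(x,y)=(axb^{ -1},bya^{ -1})$. $S(x)=\{i:x(i)\ne i\}$. For $x\in S_{2n}$ the graph $\Gamma_x$ has vertices $v_i=(i,x(i))$, $i\in[2n]$, straight edges $(v_{2i-1}:v_{2i})$ and curved edges $(v_{x^{ -1}(2i-1)}:v_{x^{ -1}(2i)})$, $i=1,\dots,n$; if its components have sizes $2s_1\ge\dots\ge2s_k$, the stable coset type $\mu_x$ is the partition with parts $s_j-1$ (zeros discarded), independent of $n$. $K_\mu=\{x\in S_{2\infty}:\mu_x=\mu\}$ and $K_\nu^m=\{x\in K_\nu:|S(x)|=m\}$. -}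

module Defs where

open import Data.Nat using (ℕ; zero; suc; _+_; _*_; _∸_; _≤_; _<_)
open import Data.List using (List; []; _∷_; length; map)
open import Data.Nat.ListAction using (sum)
open import Data.List.Relation.Unary.All using (All)
open import Data.List.Relation.Unary.Any using (Any)
open import Data.List.Relation.Unary.AllPairs using (AllPairs)
open import Data.List.Relation.Unary.Unique.Propositional using (Unique)
open import Data.List.Relation.Unary.Linked using (Linked)
open import Data.List.Membership.Propositional using (_∈_)
open import Data.List.Relation.Binary.Permutation.Propositional using (_↭_)
open import Data.Product using (Σ; ∃; ∃-syntax; _×_; _,_; proj₁; proj₂)
open import Relation.Binary.PropositionalEquality using (_≡_; _≢_)
open import Relation.Binary.Construct.Closure.ReflexiveTransitive using (Star)
open import Data.Sum using (_⊎_)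
open import Relation.Nullary using (¬_)
open import Function.Bundles using (_⇔_)

-- CONVENTION: the positive integer k is encoded as the natural number k - 1.
-- So the blocks {2i-1, 2i} become {2i-2, 2i-1}, i.e. {2k, 2k+1} (k ≥ 0).

-- Partner in the block: 2k ↦ 2k+1, 2k+1 ↦ 2k  (this is the involution
-- (1 2)(3 4)(5 6)... written 0-based).
pt : ℕ → ℕ
pt zero = 1
pt (suc zero) = 0
pt (suc (suc n)) = suc (suc (pt n))

record Partition : Set where
  field
    parts    : List ℕ
    positive : All (λ p → 0 < p) parts
    nonincr  : Linked (λ a b → b ≤ a) parts
open Partition public

len : Partition → ℕ
len μ = length (parts μ)

size : Partition → ℕ
size μ = sum (parts μ)

w : Partition → ℕ
w μ = len μ + size μ

HasCard : (ℕ → Set) → ℕ → Set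
HasCard P m = ∃[ L ] (Unique L × (∀ i → (i ∈ L) ⇔ P i) × length L ≡ m)

record Perm : Set where
  field
    fun  : ℕ → ℕ
    inv  : ℕ → ℕ
    inv-fun : ∀ i → inv (fun i) ≡ i
    fun-inv : ∀ i → fun (inv i) ≡ i
open Perm public

InS2 : ℕ → Perm → Set
InS2 n x = ∀ i → 2 * n ≤ i → fun x i ≡ i

InS2∞ : Perm → Set
InS2∞ x = ∃[ n ] InS2 n x

InB : ℕ → Perm → Set
InB n a = InS2 n a × (∀ i → i < 2 * n → fun a (pt i) ≡ pt (fun a i))

InB∞ : Perm → Set
InB∞ a = ∃[ n ] InB n a

-- product xy (apply y first)
_·_ : Perm → Perm → Perm
x · y = record
  { fun = λ i → fun x (fun y i)
  ; inv = λ i → inv y (inv x i)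
  ; inv-fun = λ i → trans' (Relation.Binary.PropositionalEquality.cong (inv y) (inv-fun x (fun y i))) (inv-fun y i)
  ; fun-inv = λ i → trans' (Relation.Binary.PropositionalEquality.cong (fun x) (fun-inv y (inv x i))) (fun-inv x i)
  }
  where open import Relation.Binary.PropositionalEquality using () renaming (trans to trans')

Moved : Perm → ℕ → Set
Moved x m = HasCard (λ i → fun x i ≢ i) m

-- The graph Γ_x (stable version: vertex v_i = (i, x(i)) for every i ∈ ℕ;
-- for i outside the support the block {v_2k, v_2k+1} is a component of size 2,
-- which contributes a zero part and is discarded).

-- straight edge (v_{2k} : v_{2k+1}); curved edge (v_{x⁻¹(2k)} : v_{x⁻¹(2k+1)})
Straight : Perm → ℕ → ℕ → Set
Straight x i j = j ≡ pt i

Curved : Perm → ℕ → ℕ → Set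
Curved x i j = j ≡ inv x (pt (fun x i))

Edge : Perm → ℕ → ℕ → Set
Edge x i j = Straight x i j ⊎ Curved x i j

Connected : Perm → ℕ → ℕ → Set
Connected x = Star (Edge x)

CompSize : Perm → ℕ → ℕ → Set
CompSize x i m = HasCard (Connected x i) m

-- μ_x = μ: there is a list of pairs (r_j, s_j), one representative r_j for
-- each component of size 2 s_j > 2 (pairwise distinct components, covering
-- every component of size ≠ 2), and the multiset of s_j - 1 is μ.
CosetType : Perm → Partition → Set
CosetType x μ =
  ∃[ comps ]
    ( All (λ p → CompSize x (proj₁ p) (2 * proj₂ p) × 2 ≤ proj₂ p) comps
    × AllPairs (λ p q → ¬ Connected x (proj₁ p) (proj₁ q)) comps
    × (∀ i → ¬ CompSize x i 2 → Any (λ p → Connected x (proj₁ p) i) comps)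
    × map (λ p → proj₂ p ∸ 1) comps ↭ parts μ )

InK : Partition → Perm → Set
InK μ x = InS2∞ x × CosetType x μ

InKm : Partition → ℕ → Perm → Set
InKm ν m x = InK ν x × Moved x m

InV : Partition → Partition → Partition → Perm × Perm → Set
InV μ κ ν (x , y) = InK μ x × InK κ y × InKm ν (w ν) (x · y)

InOrbit : Perm × Perm → Perm × Perm → Set
InOrbit (x , y) (x' , y') =
  ∃[ a ] ∃[ b ] ( InB∞ a × InB∞ b
    × (∀ i → fun x' i ≡ fun a (fun x (inv b i)))
    × (∀ i → fun y' i ≡ fun b (fun y (inv a i))) )

FiniteUnionOfOrbits : (Perm × Perm → Set) → Set
FiniteUnionOfOrbits V =
  ∃[ L ] ( All (λ p → InS2∞ (proj₁ p) × InS2∞ (proj₂ p)) L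
         × (∀ q → V q ⇔ Any (λ p → InOrbit p q) L) )

module Submission where

-- The proof:
--  1. B∞ is a group, and the action preserves V: if x' = a x b⁻¹ with a, b ∈ B∞
--     then b is an isomorphism of the graphs Γ_x ≅ Γ_x' (so μ_x = μ_x'), and
--     x' y' = a (x y) a⁻¹ moves as many points as x y.
--  2. Compression: for (x, y) ∈ V, at most N = w(ν) + 2 w(μ) blocks are "bad"
--     (they meet S(x y) or the x-image of a nontrivial component of Γ_x).  If
--     x, y ∈ S_{2(M+1)} with M ≥ N, a good block can be moved to block M and then
--     fixed by both factors, using two explicit elements of B∞.  Iterating,
--     every orbit in V meets S_{2N} × S_{2N}.
--  3. Finiteness: S_{2N} is enumerated by an explicit list of permutations, and
--     membership in V is decidable for pairs in S_{2N} × S_{2N} (components of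
--     Γ_x are computed as finite cycles).  The pairs of V in the enumeration are
--     the required base points.

open import Defs
open import Data.Nat using (ℕ; zero; suc; _+_; _*_; _∸_; _≤_; _<_; _≟_; _≤?_; _<?_; z≤n; s≤s; _⊔_)
open import Data.Nat.Properties
open import Data.Nat.ListAction using (sum)
open import Data.Nat.ListAction.Properties using (sum-↭)
open import Data.Bool using (Bool; true; false; not; _xor_; _∧_)
open import Data.Bool.Properties using (xor-assoc; xor-same; xor-identityʳ; not-distribˡ-xor)
open import Data.Fin using (toℕ; fromℕ<)
open import Data.Fin.Properties using (pigeonhole; toℕ-fromℕ<)
open import Data.Product using (∃-syntax; _×_; _,_; proj₁; proj₂)
open import Data.Sum using (_⊎_; inj₁; inj₂)
open import Data.Empty using (⊥-elim)
open import Function using (_∘_; case_of_)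
open import Function.Bundles using (_⇔_; mk⇔; Equivalence)
open import Relation.Nullary using (¬_; Dec; yes; no; does)
open import Relation.Nullary.Decidable using (dec-true; dec-false; map′; ¬?; _×-dec_; _→-dec_; decidable-stable)
open import Relation.Binary.PropositionalEquality
open import Relation.Binary.Construct.Closure.ReflexiveTransitive using (Star; ε; _◅_; _◅◅_; gmap)
open import Data.List using (List; []; _∷_; length; map; _++_; upTo; filter; deduplicate; cartesianProductWith; cartesianProduct)
open import Data.List.Properties using (length-map; length-++; length-++-sucʳ; map-∘; length-upTo)
open import Data.List.Membership.Propositional using (_∈_; _∉_; lose; find)
open import Data.List.Membership.Propositional.Properties
  using (∈-map⁺; ∈-map⁻; ∈-∃++; ∈-++⁺ˡ; ∈-++⁺ʳ; ∈-++⁻; ∈-upTo⁺; ∈-upTo⁻; deduplicate-∈⇔; ∈-filter⁺; ∈-filter⁻;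
         ∈-cartesianProductWith⁺; ∈-cartesianProductWith⁻; ∈-cartesianProduct⁺; ∈-cartesianProduct⁻)
open import Data.List.Membership.DecPropositional _≟_ using (_∈?_)
open import Data.List.Relation.Unary.All as All using (All; []; _∷_; all?)
open import Data.List.Relation.Unary.Any as Any using (Any; here; there; any?)
open import Data.List.Relation.Unary.AllPairs as AllPairs using (AllPairs; []; _∷_; allPairs?)
open import Data.List.Relation.Unary.Unique.Propositional using (Unique)
open import Data.List.Relation.Unary.Unique.DecPropositional.Properties _≟_ using (deduplicate-!)
open import Data.List.Relation.Binary.Permutation.Propositional using (_↭_; ↭-refl; ↭-sym; ↭-trans; prep)
open import Data.List.Relation.Binary.Permutation.Propositional.Properties using (¬x∷xs↭[]; ∈-resp-↭; shift; drop-∷; ↭-length)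
import Data.List.Relation.Unary.All.Properties as AllP
import Data.List.Relation.Unary.Any.Properties as AnyP
import Data.List.Relation.Unary.AllPairs.Properties as AllPairsP
import Data.List.Relation.Unary.Unique.Propositional.Properties as UniqueP

-- Blocks.  Every i : ℕ is  point (block i) (side i),  the point on side
-- false (even) or true (odd) of block {2b, 2b+1};  pt exchanges the sides.

block : ℕ → ℕ
block zero = zero
block (suc zero) = zero
block (suc (suc n)) = suc (block n)

side : ℕ → Bool
side zero = false
side (suc zero) = true
side (suc (suc n)) = side n

point : ℕ → Bool → ℕ
point zero false = 0
point zero true = 1
point (suc b) s = suc (suc (point b s))

block-point : ∀ b s → block (point b s) ≡ b
block-point zero false = refl
block-point zero true = refl
block-point (suc b) s = cong suc (block-point b s)

side-point : ∀ b s → side (point b s) ≡ s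
side-point zero false = refl
side-point zero true = refl
side-point (suc b) s = side-point b s

point-block-side : ∀ i → point (block i) (side i) ≡ i
point-block-side zero = refl
point-block-side (suc zero) = refl
point-block-side (suc (suc i)) = cong (suc ∘ suc) (point-block-side i)

pt-point : ∀ i → pt i ≡ point (block i) (not (side i))
pt-point zero = refl
pt-point (suc zero) = refl
pt-point (suc (suc i)) = cong (suc ∘ suc) (pt-point i)

block-pt : ∀ i → block (pt i) ≡ block i
block-pt i = trans (cong block (pt-point i)) (block-point (block i) (not (side i)))

side-pt : ∀ i → side (pt i) ≡ not (side i)
side-pt i = trans (cong side (pt-point i)) (side-point (block i) (not (side i)))

pt-point-false : ∀ b → pt (point b false) ≡ point b true
pt-point-false b = trans (pt-point _) (cong₂ point (block-point b false) (cong not (side-point b false)))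

point-false : ∀ b → point b false ≡ 2 * b
point-false zero = refl
point-false (suc b) = trans (cong (suc ∘ suc) (point-false b)) (sym (*-suc 2 b))

block-double : ∀ b → block (2 * b) ≡ b
block-double b = trans (cong block (sym (point-false b))) (block-point b false)

pt-pt : ∀ i → pt (pt i) ≡ i
pt-pt zero = refl
pt-pt (suc zero) = refl
pt-pt (suc (suc i)) = cong (suc ∘ suc) (pt-pt i)

pt-no-fixpoint : ∀ i → pt i ≢ i
pt-no-fixpoint zero ()
pt-no-fixpoint (suc zero) ()
pt-no-fixpoint (suc (suc i)) e = pt-no-fixpoint i (suc-injective (suc-injective e))

pt-injective : ∀ {i j} → pt i ≡ pt j → i ≡ j
pt-injective {i} {j} e = trans (sym (pt-pt i)) (trans (cong pt e) (pt-pt j))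

point-≥ : ∀ b s → 2 * b ≤ point b s
point-≥ b false = ≤-reflexive (sym (point-false b))
point-≥ zero true = z≤n
point-≥ (suc b) true = subst (_≤ suc (suc (point b true))) (sym (*-suc 2 b)) (s≤s (s≤s (point-≥ b true)))

block-≥⇒≥ : ∀ n i → n ≤ block i → 2 * n ≤ i
block-≥⇒≥ n i le = subst (2 * n ≤_) (point-block-side i) (≤-trans (*-monoʳ-≤ 2 le) (point-≥ (block i) (side i)))

point-< : ∀ b s → point b s < 2 * suc b
point-< zero false = s≤s z≤n
point-< zero true = s≤s (s≤s z≤n)
point-< (suc b) s =
  subst (suc (suc (suc (point b s))) ≤_) (sym (*-suc 2 (suc b))) (s≤s (s≤s (point-< b s)))

≥⇒block-≥ : ∀ n i → 2 * n ≤ i → n ≤ block i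
≥⇒block-≥ n i le = ≮⇒≥ λ lt → <⇒≱ (subst (_< 2 * n) (point-block-side i)
  (≤-trans (point-< (block i) (side i)) (*-monoʳ-≤ 2 lt))) le

pt-≥ : ∀ n i → 2 * n ≤ i → 2 * n ≤ pt i
pt-≥ n i le = block-≥⇒≥ n (pt i) (subst (n ≤_) (sym (block-pt i)) (≥⇒block-≥ n i le))

pt-< : ∀ n i → i < 2 * n → pt i < 2 * n
pt-< n i lt = ≰⇒> (λ le → <⇒≱ lt (subst (2 * n ≤_) (pt-pt i) (pt-≥ n (pt i) le)))

≥-block-or-beyond : ∀ M i → 2 * M ≤ i → i ≡ point M false ⊎ i ≡ point M true ⊎ 2 * suc M ≤ i
≥-block-or-beyond M i le with m≤n⇒m<n∨m≡n (≥⇒block-≥ M i le)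
... | inj₁ beyond = inj₂ (inj₂ (block-≥⇒≥ (suc M) i beyond))
... | inj₂ refl with side i in eq
...   | false = inj₁ (trans (sym (point-block-side i)) (cong (point (block i)) eq))
...   | true = inj₂ (inj₁ (trans (sym (point-block-side i)) (cong (point (block i)) eq)))

idP : Perm
idP = record { fun = λ i → i ; inv = λ i → i ; inv-fun = λ _ → refl ; fun-inv = λ _ → refl }

invP : Perm → Perm
invP x = record { fun = inv x ; inv = fun x ; inv-fun = fun-inv x ; fun-inv = inv-fun x }

fun-injective : ∀ x {i j} → fun x i ≡ fun x j → i ≡ j
fun-injective x {i} {j} e = trans (sym (inv-fun x i)) (trans (cong (inv x) e) (inv-fun x j))

inv-unique : ∀ x {j k} → fun x j ≡ k → inv x k ≡ j
inv-unique x {j} e = trans (cong (inv x) (sym e)) (inv-fun x j)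

Fix : ℕ → Perm → Set
Fix m x = ∀ i → m ≤ i → fun x i ≡ i

Fix-mono : ∀ {m m'} x → m ≤ m' → Fix m x → Fix m' x
Fix-mono x le f i le' = f i (≤-trans le le')

Fix-inv : ∀ {m} x → Fix m x → Fix m (invP x)
Fix-inv x f i le = inv-unique x (f i le)

Fix-· : ∀ {m} x y → Fix m x → Fix m y → Fix m (x · y)
Fix-· x y fx fy i le = trans (cong (fun x) (fy i le)) (fx i le)

Fix-< : ∀ {m} x → Fix m x → ∀ i → i < m → fun x i < m
Fix-< {m} x f i lt = ≰⇒> (λ le → <⇒≱ lt (subst (m ≤_) (fun-injective x (f (fun x i) le)) le))

CommutesPt : Perm → Set
CommutesPt a = ∀ i → fun a (pt i) ≡ pt (fun a i)

-- Elements of B_n commute with pt everywhere (beyond 2n both sides are fixed).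
InB⇒CommutesPt : ∀ {n} a → InB n a → CommutesPt a
InB⇒CommutesPt {n} a (fixes , commutes) i with i <? 2 * n
... | yes lt = commutes i lt
... | no ge = trans (fixes (pt i) (pt-≥ n i (≮⇒≥ ge))) (cong pt (sym (fixes i (≮⇒≥ ge))))

CommutesPt-inv : ∀ a → CommutesPt a → CommutesPt (invP a)
CommutesPt-inv a c i = inv-unique a (trans (c (inv a i)) (cong pt (fun-inv a i)))

CommutesPt-· : ∀ a b → CommutesPt a → CommutesPt b → CommutesPt (a · b)
CommutesPt-· a b ca cb i = trans (cong (fun a) (cb i)) (ca (fun b i))

B∞-id : InB∞ idP
B∞-id = 0 , (λ _ _ → refl) , (λ _ _ → refl)

B∞-inv : ∀ a → InB∞ a → InB∞ (invP a)
B∞-inv a (n , b) = n , Fix-inv a (proj₁ b) , λ i _ → CommutesPt-inv a (InB⇒CommutesPt {n} a b) i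

B∞-· : ∀ a b → InB∞ a → InB∞ b → InB∞ (a · b)
B∞-· a b (n , ba) (m , bb) = n ⊔ m , Fix-· a b (widen a (m≤m⊔n n m) (proj₁ ba)) (widen b (m≤n⊔m n m) (proj₁ bb)) ,
  λ i _ → CommutesPt-· a b (InB⇒CommutesPt {n} a ba) (InB⇒CommutesPt {m} b bb) i
  where
    widen : ∀ {k} c → k ≤ n ⊔ m → Fix (2 * k) c → Fix (2 * (n ⊔ m)) c
    widen {k} c le = Fix-mono c (*-monoʳ-≤ 2 {k} {n ⊔ m} le)

involution : (f : ℕ → ℕ) → (∀ i → f (f i) ≡ i) → Perm
involution f ff = record { fun = f ; inv = f ; inv-fun = ff ; fun-inv = ff }

swap : ℕ → ℕ → ℕ → ℕ
swap a b n with n ≟ a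
... | yes _ = b
... | no _ with n ≟ b
...   | yes _ = a
...   | no _ = n

swap-left : ∀ a b → swap a b a ≡ b
swap-left a b with a ≟ a
... | yes _ = refl
... | no a≢a = ⊥-elim (a≢a refl)

swap-right : ∀ a b → swap a b b ≡ a
swap-right a b with b ≟ a
... | yes b≡a = b≡a
... | no _ with b ≟ b
...   | yes _ = refl
...   | no b≢b = ⊥-elim (b≢b refl)

swap-other : ∀ a b n → n ≢ a → n ≢ b → swap a b n ≡ n
swap-other a b n n≢a n≢b with n ≟ a
... | yes n≡a = ⊥-elim (n≢a n≡a)
... | no _ with n ≟ b
...   | yes n≡b = ⊥-elim (n≢b n≡b)
...   | no _ = refl

swap-involutive : ∀ a b n → swap a b (swap a b n) ≡ n
swap-involutive a b n with n ≟ a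
... | yes refl = swap-right a b
... | no n≢a with n ≟ b
...   | yes refl = swap-left a b
...   | no n≢b = swap-other a b n n≢a n≢b

transposition : ℕ → ℕ → Perm
transposition a b = involution (swap a b) (swap-involutive a b)

blockMap : (ℕ → ℕ) → (ℕ → Bool) → ℕ → ℕ
blockMap σ F i = point (σ (block i)) (side i xor F (block i))

blockMap-pt : ∀ σ F i → blockMap σ F (pt i) ≡ pt (blockMap σ F i)
blockMap-pt σ F i = begin
    point (σ (block (pt i))) (side (pt i) xor F (block (pt i)))
  ≡⟨ cong₂ (λ b s → point (σ b) (s xor F b)) (block-pt i) (side-pt i) ⟩
    point (σ (block i)) (not (side i) xor F (block i))
  ≡⟨ cong (point (σ (block i))) (sym (not-distribˡ-xor (side i) (F (block i)))) ⟩
    point (σ (block i)) (not (side i xor F (block i)))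
  ≡⟨ cong₂ (λ b s → point b (not s)) (sym (block-point (σ (block i)) _)) (sym (side-point (σ (block i)) _)) ⟩
    point (block (blockMap σ F i)) (not (side (blockMap σ F i)))
  ≡⟨ sym (pt-point (blockMap σ F i)) ⟩
    pt (blockMap σ F i) ∎
  where open ≡-Reasoning

blockMap-involutive : ∀ σ F → (∀ n → σ (σ n) ≡ n) → (∀ n → F (σ n) ≡ F n) →
                      ∀ i → blockMap σ F (blockMap σ F i) ≡ i
blockMap-involutive σ F σσ Fσ i = begin
    point (σ (block (blockMap σ F i))) (side (blockMap σ F i) xor F (block (blockMap σ F i)))
  ≡⟨ cong₂ (λ b s → point (σ b) (s xor F b)) (block-point (σ (block i)) _) (side-point (σ (block i)) _) ⟩
    point (σ (σ (block i))) ((side i xor F (block i)) xor F (σ (block i)))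
  ≡⟨ cong₂ point (σσ (block i)) (cong ((side i xor F (block i)) xor_) (Fσ (block i))) ⟩
    point (block i) ((side i xor F (block i)) xor F (block i))
  ≡⟨ cong (point (block i)) (xor-cancel (side i) (F (block i))) ⟩
    point (block i) (side i)
  ≡⟨ point-block-side i ⟩
    i ∎
  where
    open ≡-Reasoning
    xor-cancel : ∀ p q → (p xor q) xor q ≡ p
    xor-cancel p q = trans (xor-assoc p q q) (trans (cong (p xor_) (xor-same q)) (xor-identityʳ p))

blockMap-fixes : ∀ σ F i → σ (block i) ≡ block i → F (block i) ≡ false → blockMap σ F i ≡ i
blockMap-fixes σ F i σb Fb =
  trans (cong₂ point σb (trans (cong (side i xor_) Fb) (xor-identityʳ (side i)))) (point-block-side i)

blockSwap : ℕ → ℕ → Perm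
blockSwap a b = involution (blockMap (swap a b) (λ _ → false))
  (blockMap-involutive (swap a b) (λ _ → false) (swap-involutive a b) (λ _ → refl))

flipBlock : ℕ → Bool → Perm
flipBlock c s = involution (blockMap (λ n → n) (λ n → does (n ≟ c) ∧ s))
  (blockMap-involutive (λ n → n) (λ n → does (n ≟ c) ∧ s) (λ _ → refl) (λ _ → refl))

moveTo : ℕ → ℕ → Perm
moveTo u v = flipBlock (block v) (side u xor side v) · blockSwap (block u) (block v)

moveTo-sends : ∀ u v → fun (moveTo u v) u ≡ v
moveTo-sends u v = begin
    blockMap (λ n → n) F (point (swap (block u) (block v) (block u)) (side u xor false))
  ≡⟨ cong₂ (λ b s → blockMap (λ n → n) F (point b s)) (swap-left (block u) (block v)) (xor-identityʳ (side u)) ⟩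
    blockMap (λ n → n) F (point (block v) (side u))
  ≡⟨ cong₂ (λ b s → point b (s xor F b)) (block-point (block v) (side u)) (side-point (block v) (side u)) ⟩
    point (block v) (side u xor (does (block v ≟ block v) ∧ (side u xor side v)))
  ≡⟨ cong (λ d → point (block v) (side u xor (d ∧ (side u xor side v)))) (dec-true (block v ≟ block v) refl) ⟩
    point (block v) (side u xor (side u xor side v))
  ≡⟨ cong (point (block v)) (trans (sym (xor-assoc (side u) (side u) (side v))) (cong (_xor side v) (xor-same (side u)))) ⟩
    point (block v) (side v)
  ≡⟨ point-block-side v ⟩
    v ∎
  where
    open ≡-Reasoning
    F : ℕ → Bool
    F n = does (n ≟ block v) ∧ (side u xor side v)

moveTo-commutes : ∀ u v → CommutesPt (moveTo u v)
moveTo-commutes u v = CommutesPt-· (flipBlock (block v) (side u xor side v)) (blockSwap (block u) (block v))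
  (blockMap-pt (λ n → n) (λ n → does (n ≟ block v) ∧ (side u xor side v)))
  (blockMap-pt (swap (block u) (block v)) (λ _ → false))

moveTo-Fix : ∀ u v → Fix (2 * suc (block u ⊔ block v)) (moveTo u v)
moveTo-Fix u v i le = trans (cong (fun (flipBlock (block v) (side u xor side v))) swapFixes) flipFixes
  where
    beyond : block u ⊔ block v < block i
    beyond = ≥⇒block-≥ (suc (block u ⊔ block v)) i le
    ≢u : block i ≢ block u
    ≢u e = <⇒≢ (≤-<-trans (m≤m⊔n (block u) (block v)) beyond) (sym e)
    ≢v : block i ≢ block v
    ≢v e = <⇒≢ (≤-<-trans (m≤n⊔m (block u) (block v)) beyond) (sym e)
    swapFixes : fun (blockSwap (block u) (block v)) i ≡ i
    swapFixes = blockMap-fixes (swap (block u) (block v)) (λ _ → false) i (swap-other (block u) (block v) (block i) ≢u ≢v) refl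
    flipFixes : fun (flipBlock (block v) (side u xor side v)) i ≡ i
    flipFixes = blockMap-fixes (λ n → n) (λ n → does (n ≟ block v) ∧ (side u xor side v)) i refl (cong (_∧ (side u xor side v)) (dec-false (block i ≟ block v) ≢v))

moveTo-B∞ : ∀ u v → InB∞ (moveTo u v)
moveTo-B∞ u v = suc (block u ⊔ block v) , moveTo-Fix u v , λ i _ → moveTo-commutes u v i

Translate : Perm → Perm → Perm → Perm → Set
Translate a b x x' = ∀ i → fun x' i ≡ fun a (fun x (inv b i))

Translate-back : ∀ a b {x x'} → Translate a b x x' → Translate (invP a) (invP b) x' x
Translate-back a b {x} h i =
  sym (trans (cong (inv a) (h (fun b i))) (trans (inv-fun a _) (cong (fun x) (inv-fun b i))))

Translate-Fix : ∀ {a b x x' m} → Translate a b x x' → Fix m a → Fix m x → Fix m b → Fix m x'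
Translate-Fix {a} {b} {x} h fa fx fb i le =
  trans (h i) (trans (cong (fun a ∘ fun x) (Fix-inv b fb i le)) (trans (cong (fun a) (fx i le)) (fa i le)))

Translate-· : ∀ {a b x y x' y'} → Translate a b x x' → Translate b a y y' → Translate a a (x · y) (x' · y')
Translate-· {a} {b} {x} {y} {x'} {y'} hx hy i =
  trans (hx (fun y' i)) (cong (fun a ∘ fun x) (trans (cong (inv b) (hy i)) (inv-fun b _)))

InOrbit-refl : ∀ p → InOrbit p p
InOrbit-refl (x , y) = idP , idP , B∞-id , B∞-id , (λ _ → refl) , (λ _ → refl)

InOrbit-sym : ∀ {p q} → InOrbit p q → InOrbit q p
InOrbit-sym {x , y} {x' , y'} (a , b , ba , bb , hx , hy) =
  invP a , invP b , B∞-inv a ba , B∞-inv b bb , Translate-back a b {x} {x'} hx , Translate-back b a {y} {y'} hy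

InOrbit-trans : ∀ {p q r} → InOrbit p q → InOrbit q r → InOrbit p r
InOrbit-trans (a₁ , b₁ , ba₁ , bb₁ , hx₁ , hy₁) (a₂ , b₂ , ba₂ , bb₂ , hx₂ , hy₂) =
  a₂ · a₁ , b₂ · b₁ , B∞-· a₂ a₁ ba₂ ba₁ , B∞-· b₂ b₁ bb₂ bb₁ ,
  (λ i → trans (hx₂ i) (cong (fun a₂) (hx₁ (inv b₂ i)))) ,
  (λ i → trans (hy₂ i) (cong (fun b₂) (hy₁ (inv a₂ i))))

-- If x' = a x b⁻¹ with a, b ∈ B∞, then
-- b maps the graph Γ_x isomorphically onto Γ_x' (a, b preserve blocks),
-- so x and x' have the same coset type; and conjugation preserves |S(-)|.

open Equivalence using (to; from)

Translate-Edge : ∀ a b x x' → CommutesPt a → CommutesPt b → Translate a b x x' →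
                 ∀ {i j} → Edge x i j → Edge x' (fun b i) (fun b j)
Translate-Edge a b x x' ca cb h {i} {j} (inj₁ straight) = inj₁ (trans (cong (fun b) straight) (cb i))
Translate-Edge a b x x' ca cb h {i} {j} (inj₂ curved) = inj₂ (sym (inv-unique x' x'bj))
  where
    h' : ∀ k → fun x' (fun b k) ≡ fun a (fun x k)
    h' k = trans (h (fun b k)) (cong (fun a ∘ fun x) (inv-fun b k))
    x'bj : fun x' (fun b j) ≡ pt (fun x' (fun b i))
    x'bj = begin
      fun x' (fun b j)                      ≡⟨ h' j ⟩
      fun a (fun x j)                       ≡⟨ cong (fun a ∘ fun x) curved ⟩
      fun a (fun x (inv x (pt (fun x i))))  ≡⟨ cong (fun a) (fun-inv x _) ⟩
      fun a (pt (fun x i))                  ≡⟨ ca (fun x i) ⟩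
      pt (fun a (fun x i))                  ≡⟨ cong pt (sym (h' i)) ⟩
      pt (fun x' (fun b i))                 ∎
      where open ≡-Reasoning

record GraphIso (x x' : Perm) : Set where
  field
    φ ψ : ℕ → ℕ
    ψφ : ∀ i → ψ (φ i) ≡ i
    φψ : ∀ i → φ (ψ i) ≡ i
    φ-connected : ∀ {i j} → Connected x i j → Connected x' (φ i) (φ j)
    ψ-connected : ∀ {i j} → Connected x' i j → Connected x (ψ i) (ψ j)

Translate-GraphIso : ∀ a b x x' → CommutesPt a → CommutesPt b → Translate a b x x' → GraphIso x x'
Translate-GraphIso a b x x' ca cb h = record
  { φ = fun b ; ψ = inv b ; ψφ = inv-fun b ; φψ = fun-inv b
  ; φ-connected = gmap (fun b) (Translate-Edge a b x x' ca cb h)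
  ; ψ-connected = gmap (inv b) (Translate-Edge (invP a) (invP b) x' x (CommutesPt-inv a ca) (CommutesPt-inv b cb) (Translate-back a b {x} {x'} h))
  }

HasCard-transport : ∀ {P P' : ℕ → Set} {n} (φ ψ : ℕ → ℕ) → (∀ i → ψ (φ i) ≡ i) → (∀ i → φ (ψ i) ≡ i) →
                    (∀ k → P' k ⇔ P (ψ k)) → HasCard P n → HasCard P' n
HasCard-transport {P} {P'} φ ψ ψφ φψ P'⇔P (L , unique , members , len) =
  map φ L , UniqueP.map⁺ φ-injective unique , (λ k → mk⇔ (sound k) (complete k)) , trans (length-map φ L) len
  where
    φ-injective : ∀ {i j} → φ i ≡ φ j → i ≡ j
    φ-injective {i} {j} e = trans (sym (ψφ i)) (trans (cong ψ e) (ψφ j))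
    sound : ∀ k → k ∈ map φ L → P' k
    sound k k∈ with ∈-map⁻ φ k∈
    ... | l , l∈L , refl = from (P'⇔P (φ l)) (subst P (sym (ψφ l)) (to (members l) l∈L))
    complete : ∀ k → P' k → k ∈ map φ L
    complete k pk = subst (_∈ map φ L) (φψ k) (∈-map⁺ φ (from (members (ψ k)) (to (P'⇔P k) pk)))

module _ {x x'} (I : GraphIso x x') where
  open GraphIso I

  CompSize-transport : ∀ {r n} → CompSize x r n → CompSize x' (φ r) n
  CompSize-transport {r} = HasCard-transport φ ψ ψφ φψ λ k →
    mk⇔ (λ c → subst (λ t → Connected x t (ψ k)) (ψφ r) (ψ-connected c))
        (λ c → subst (Connected x' (φ r)) (φψ k) (φ-connected c))

  CosetType-transport : ∀ {μ} → CosetType x μ → CosetType x' μ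
  CosetType-transport {μ} (comps , sizes , apart , cover , type) =
    map relabel comps ,
    AllP.map⁺ (All.map (λ (cs , large) → CompSize-transport cs , large) sizes) ,
    AllPairsP.map⁺ (AllPairs.map (λ {p} {q} nc c → nc (subst₂ (Connected x) (ψφ (proj₁ p)) (ψφ (proj₁ q)) (ψ-connected c))) apart) ,
    cover' ,
    subst (_↭ parts μ) (map-∘ comps) type
    where
      relabel : ℕ × ℕ → ℕ × ℕ
      relabel (r , s) = φ r , s
      cover' : ∀ i → ¬ CompSize x' i 2 → Any (λ p → Connected x' (proj₁ p) i) (map relabel comps)
      cover' i nontrivial = AnyP.map⁺ (Any.map (λ c → subst (Connected x' _) (φψ i) (φ-connected c))
        (cover (ψ i) (λ cs → nontrivial (subst (λ t → CompSize x' t 2) (φψ i) (CompSize-transport cs)))))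

Moved-conjugate : ∀ a {z z'} → Translate a a z z' → ∀ {n} → Moved z n → Moved z' n
Moved-conjugate a {z} {z'} h = HasCard-transport (fun a) (inv a) (inv-fun a) (fun-inv a) λ k →
  mk⇔ (λ moved e → moved (trans (h k) (trans (cong (fun a) e) (fun-inv a k))))
      (λ moved e → moved (sym (inv-unique a (trans (sym (h k)) e))))

InS2∞-transport : ∀ a b x x' → InB∞ a → InB∞ b → Translate a b x x' → InS2∞ x → InS2∞ x'
InS2∞-transport a b x x' (na , fa , _) (nb , fb , _) h (nx , fx) =
  n , Translate-Fix {a} {b} {x} {x'} h (widen a (≤-trans (m≤m⊔n na nx) (m≤m⊔n (na ⊔ nx) nb)) fa)
                              (widen x (≤-trans (m≤n⊔m na nx) (m≤m⊔n (na ⊔ nx) nb)) fx)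
                              (widen b (m≤n⊔m (na ⊔ nx) nb) fb)
  where
    n : ℕ
    n = na ⊔ nx ⊔ nb
    widen : ∀ {k} c → k ≤ n → Fix (2 * k) c → Fix (2 * n) c
    widen {k} c le = Fix-mono c (*-monoʳ-≤ 2 {k} {n} le)

InK-transport : ∀ {μ} a b x x' → InB∞ a → InB∞ b → Translate a b x x' → InK μ x → InK μ x'
InK-transport {μ} a b x x' ba bb h (s2 , type) =
  InS2∞-transport a b x x' ba bb h s2 ,
  CosetType-transport (Translate-GraphIso a b x x' (InB⇒CommutesPt {proj₁ ba} a (proj₂ ba)) (InB⇒CommutesPt {proj₁ bb} b (proj₂ bb)) h) {μ} type

InV-transport : ∀ μ κ ν {p q} → InOrbit p q → InV μ κ ν p → InV μ κ ν q
InV-transport μ κ ν {x , y} {x' , y'} (a , b , ba , bb , hx , hy) (kx , ky , kxy , moved) =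
  InK-transport {μ} a b x x' ba bb hx kx , InK-transport {κ} b a y y' bb ba hy ky ,
  InK-transport {ν} a a (x · y) (x' · y') ba ba hxy kxy , Moved-conjugate a {x · y} {x' · y'} hxy moved
  where
    hxy : Translate a a (x · y) (x' · y')
    hxy = Translate-· {a} {b} {x} {y} {x'} {y'} hx hy

∈-remove : ∀ {k x : ℕ} as bs → k ∈ as ++ x ∷ bs → k ≢ x → k ∈ as ++ bs
∈-remove as bs k∈ k≢x with ∈-++⁻ as k∈
... | inj₁ k∈as = ∈-++⁺ˡ k∈as
... | inj₂ (here k≡x) = ⊥-elim (k≢x k≡x)
... | inj₂ (there k∈bs) = ∈-++⁺ʳ as k∈bs

Unique-⊆-length : ∀ {L₁ L₂ : List ℕ} → Unique L₁ → (∀ k → k ∈ L₁ → k ∈ L₂) → length L₁ ≤ length L₂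
Unique-⊆-length {[]} _ _ = z≤n
Unique-⊆-length {x ∷ xs} (x∉xs ∷ unique) ⊆L₂ with ∈-∃++ (⊆L₂ x (here refl))
... | as , bs , refl = subst (suc (length xs) ≤_) (sym (length-++-sucʳ as x bs))
  (s≤s (Unique-⊆-length unique λ k k∈xs → ∈-remove as bs (⊆L₂ k (there k∈xs)) (λ k≡x → All.lookup x∉xs k∈xs (sym k≡x))))

HasCard-unique : ∀ {P : ℕ → Set} {a b} → HasCard P a → HasCard P b → a ≡ b
HasCard-unique (L₁ , u₁ , m₁ , l₁) (L₂ , u₂ , m₂ , l₂) = trans (sym l₁) (trans (≤-antisym
  (Unique-⊆-length u₁ (λ k k∈ → from (m₂ k) (to (m₁ k) k∈)))
  (Unique-⊆-length u₂ (λ k k∈ → from (m₁ k) (to (m₂ k) k∈)))) l₂)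

missing : ∀ M (L : List ℕ) → length L ≤ M → ∃[ j ] (j ≤ M × j ∉ L)
missing M L short with any? (λ j → ¬? (j ∈? L)) (upTo (suc M))
... | yes found with find found
...   | j , j∈ , j∉L = j , ≤-pred (∈-upTo⁻ j∈) , j∉L
missing M L short | no none = ⊥-elim (<⇒≱ (s≤s short) (subst (_≤ length L) (length-upTo (suc M))
  (Unique-⊆-length (UniqueP.upTo⁺ (suc M)) λ j j∈ → decidable-stable (j ∈? L) (λ j∉L → none (lose j∈ j∉L)))))

↭? : (xs ys : List ℕ) → Dec (xs ↭ ys)
↭? [] [] = yes ↭-refl
↭? [] (y ∷ ys) = no λ p → ¬x∷xs↭[] (↭-sym p)
↭? (x ∷ xs) ys with x ∈? ys
... | no x∉ys = no λ p → x∉ys (∈-resp-↭ p (here refl))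
... | yes x∈ys with ∈-∃++ x∈ys
...   | as , bs , refl with ↭? xs (as ++ bs)
...     | yes p = yes (↭-trans (prep x p) (↭-sym (shift x as bs)))
...     | no ¬p = no λ q → ¬p (drop-∷ (↭-trans q (shift x as bs)))

listsOver : ℕ → List ℕ → List (List ℕ)
listsOver zero A = [] ∷ []
listsOver (suc k) A = cartesianProductWith _∷_ A (listsOver k A)

∈-listsOver : ∀ A (rs : List ℕ) → All (_∈ A) rs → rs ∈ listsOver (length rs) A
∈-listsOver A [] [] = here refl
∈-listsOver A (r ∷ rs) (r∈A ∷ rs⊆A) = ∈-cartesianProductWith⁺ _∷_ r∈A (∈-listsOver A rs rs⊆A)

module FilterWith {A : Set} (Q P : A → Set) (P? : ∀ a → Q a → Dec (P a)) where

  filterWith : (L : List A) → All Q L → List A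
  filterWith [] [] = []
  filterWith (a ∷ L) (q ∷ qs) with P? a q
  ... | yes _ = a ∷ filterWith L qs
  ... | no _ = filterWith L qs

  filterWith-sound : ∀ L qs {a} → a ∈ filterWith L qs → P a × Q a
  filterWith-sound (a ∷ L) (q ∷ qs) a∈ with P? a q
  filterWith-sound (a ∷ L) (q ∷ qs) (here refl) | yes p = p , q
  filterWith-sound (a ∷ L) (q ∷ qs) (there a∈) | yes _ = filterWith-sound L qs a∈
  filterWith-sound (a ∷ L) (q ∷ qs) a∈ | no _ = filterWith-sound L qs a∈

  filterWith-complete : ∀ L qs {a} → a ∈ L → P a → a ∈ filterWith L qs
  filterWith-complete (a ∷ L) (q ∷ qs) a∈ pa with P? a q
  filterWith-complete (a ∷ L) (q ∷ qs) (here refl) pa | yes _ = here refl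
  filterWith-complete (a ∷ L) (q ∷ qs) (there a∈) pa | yes _ = there (filterWith-complete L qs a∈ pa)
  filterWith-complete (a ∷ L) (q ∷ qs) (here refl) pa | no ¬pa = ⊥-elim (¬pa pa)
  filterWith-complete (a ∷ L) (q ∷ qs) (there a∈) pa | no _ = filterWith-complete L qs a∈ pa

Star-closed : ∀ {R : ℕ → ℕ → Set} (L : List ℕ) → (∀ {j k} → j ∈ L → R j k → k ∈ L) →
              ∀ {r j} → r ∈ L → Star R r j → j ∈ L
Star-closed L closed r∈ ε = r∈
Star-closed L closed r∈ (e ◅ path) = Star-closed L closed (closed r∈ e) path

-- Every vertex has one straight and one
-- curved edge, so the component of r is the cycle r, pt r, step r,
-- pt (step r), … where step = (curved edge) ∘ (straight edge).  Since x
-- fixes every point ≥ 2n this walk returns to r (pigeonhole), which makes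
-- the components finite lists and connectivity decidable.
module Components (x : Perm) (n : ℕ) (fx : Fix (2 * n) x) where

  curved : ℕ → ℕ
  curved i = inv x (pt (fun x i))

  curved-involutive : ∀ i → curved (curved i) ≡ i
  curved-involutive i =
    trans (cong (inv x ∘ pt) (fun-inv x _)) (trans (cong (inv x) (pt-pt _)) (inv-fun x i))

  step : ℕ → ℕ
  step i = curved (pt i)

  walk : ℕ → ℕ → ℕ
  walk zero i = i
  walk (suc t) i = step (walk t i)

  walk-injective : ∀ t {i j} → walk t i ≡ walk t j → i ≡ j
  walk-injective zero e = e
  walk-injective (suc t) e =
    walk-injective t (pt-injective (trans (sym (curved-involutive _)) (trans (cong curved e) (curved-involutive _))))

  walk-+ : ∀ s t i → walk (s + t) i ≡ walk s (walk t i)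
  walk-+ zero t i = refl
  walk-+ (suc s) t i = cong step (walk-+ s t i)

  walk-< : ∀ t i → i < 2 * n → walk t i < 2 * n
  walk-< zero i lt = lt
  walk-< (suc t) i lt =
    Fix-< (invP x) (Fix-inv x fx) _ (pt-< n _ (Fix-< x fx _ (pt-< n _ (walk-< t i lt))))

  curved-beyond : ∀ r → 2 * n ≤ r → curved r ≡ pt r
  curved-beyond r le = trans (cong (inv x ∘ pt) (fx r le)) (Fix-inv x fx (pt r) (pt-≥ n r le))

  period : ∀ r → ∃[ p ] (1 ≤ p × walk p r ≡ r)
  period r with r <? 2 * n
  ... | no ge = 1 , ≤-refl , trans (curved-beyond (pt r) (pt-≥ n r (≮⇒≥ ge))) (pt-pt r)
  ... | yes lt with pigeonhole (n<1+n (2 * n)) (λ k → fromℕ< (walk-< (toℕ k) r lt))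
  ...   | i , j , i<j , same = toℕ j ∸ toℕ i , m<n⇒0<n∸m i<j , sym (walk-injective (toℕ i) walk-i≡)
    where
      walk-i≡ : walk (toℕ i) r ≡ walk (toℕ i) (walk (toℕ j ∸ toℕ i) r)
      walk-i≡ = begin
        walk (toℕ i) r                          ≡⟨ sym (toℕ-fromℕ< (walk-< (toℕ i) r lt)) ⟩
        toℕ (fromℕ< (walk-< (toℕ i) r lt))      ≡⟨ cong toℕ same ⟩
        toℕ (fromℕ< (walk-< (toℕ j) r lt))      ≡⟨ toℕ-fromℕ< (walk-< (toℕ j) r lt) ⟩
        walk (toℕ j) r                          ≡⟨ cong (λ t → walk t r) (sym (m+[n∸m]≡n (<⇒≤ i<j))) ⟩
        walk (toℕ i + (toℕ j ∸ toℕ i)) r        ≡⟨ walk-+ (toℕ i) (toℕ j ∸ toℕ i) r ⟩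
        walk (toℕ i) (walk (toℕ j ∸ toℕ i) r)   ∎
        where open ≡-Reasoning

  cycleList : ℕ → ℕ → List ℕ
  cycleList r p = map (λ t → walk t r) (upTo p) ++ map (λ t → pt (walk t r)) (upTo p)

  walk∈cycle : ∀ r p t → t < p → walk t r ∈ cycleList r p
  walk∈cycle r p t lt = ∈-++⁺ˡ (∈-map⁺ (λ t → walk t r) (∈-upTo⁺ lt))

  pt-walk∈cycle : ∀ r p t → t < p → pt (walk t r) ∈ cycleList r p
  pt-walk∈cycle r p t lt = ∈-++⁺ʳ (map (λ t → walk t r) (upTo p)) (∈-map⁺ (λ t → pt (walk t r)) (∈-upTo⁺ lt))

  ∈cycle-cases : ∀ r p j → j ∈ cycleList r p → ∃[ t ] (t < p × (j ≡ walk t r ⊎ j ≡ pt (walk t r)))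
  ∈cycle-cases r p j j∈ with ∈-++⁻ (map (λ t → walk t r) (upTo p)) j∈
  ... | inj₁ j∈walk with ∈-map⁻ (λ t → walk t r) j∈walk
  ...   | t , t∈ , e = t , ∈-upTo⁻ t∈ , inj₁ e
  ∈cycle-cases r p j j∈ | inj₂ j∈pt with ∈-map⁻ (λ t → pt (walk t r)) j∈pt
  ...   | t , t∈ , e = t , ∈-upTo⁻ t∈ , inj₂ e

  cycle-closed : ∀ r p → 1 ≤ p → walk p r ≡ r → ∀ {j k} → j ∈ cycleList r p → Edge x j k → k ∈ cycleList r p
  cycle-closed r p p≥1 periodic j∈ edge with ∈cycle-cases r p _ j∈
  cycle-closed r p p≥1 periodic j∈ (inj₁ refl) | t , lt , inj₁ refl = pt-walk∈cycle r p t lt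
  cycle-closed r p p≥1 periodic j∈ (inj₁ refl) | t , lt , inj₂ refl =
    subst (_∈ cycleList r p) (sym (pt-pt _)) (walk∈cycle r p t lt)
  cycle-closed r (suc p) p≥1 periodic j∈ (inj₂ refl) | zero , lt , inj₁ refl =
    subst (_∈ cycleList r (suc p)) (sym (trans (cong curved (sym periodic)) (curved-involutive _)))
      (pt-walk∈cycle r (suc p) p ≤-refl)
  cycle-closed r p p≥1 periodic j∈ (inj₂ refl) | suc t , lt , inj₁ refl =
    subst (_∈ cycleList r p) (sym (curved-involutive _)) (pt-walk∈cycle r p t (<⇒≤ lt))
  cycle-closed r p p≥1 periodic j∈ (inj₂ refl) | t , lt , inj₂ refl with m≤n⇒m<n∨m≡n lt
  ... | inj₁ lt' = walk∈cycle r p (suc t) lt'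
  ... | inj₂ refl = subst (_∈ cycleList r p) (sym periodic) (walk∈cycle r p 0 p≥1)

  walk-connected : ∀ r t → Connected x r (walk t r)
  walk-connected r zero = ε
  walk-connected r (suc t) = walk-connected r t ◅◅ (inj₁ refl ◅ inj₂ refl ◅ ε)

  component : ℕ → List ℕ
  component r = deduplicate _≟_ (cycleList r (proj₁ (period r)))

  ∈component⇔ : ∀ r j → j ∈ component r ⇔ Connected x r j
  ∈component⇔ r j = mk⇔ sound complete
    where
      p : ℕ
      p = proj₁ (period r)
      sound : j ∈ component r → Connected x r j
      sound j∈ with ∈cycle-cases r p j (from (deduplicate-∈⇔ _≟_) j∈)
      ... | t , _ , inj₁ refl = walk-connected r t
      ... | t , _ , inj₂ refl = walk-connected r t ◅◅ (inj₁ refl ◅ ε)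
      complete : Connected x r j → j ∈ component r
      complete path = to (deduplicate-∈⇔ _≟_) (Star-closed (cycleList r p)
        (cycle-closed r p (proj₁ (proj₂ (period r))) (proj₂ (proj₂ (period r))))
        (walk∈cycle r p 0 (proj₁ (proj₂ (period r)))) path)

  component-size : ∀ r → CompSize x r (length (component r))
  component-size r = component r , deduplicate-! _ , ∈component⇔ r , refl

  Connected? : ∀ r j → Dec (Connected x r j)
  Connected? r j with j ∈? component r
  ... | yes j∈ = yes (to (∈component⇔ r j) j∈)
  ... | no j∉ = no λ path → j∉ (from (∈component⇔ r j) path)

  CompSize? : ∀ r k → Dec (CompSize x r k)
  CompSize? r k with length (component r) ≟ k
  ... | yes e = yes (component r , deduplicate-! _ , ∈component⇔ r , e)
  ... | no ne = no λ cs → ne (HasCard-unique (component-size r) cs)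

  CompSize-beyond : ∀ r → 2 * n ≤ r → CompSize x r 2
  CompSize-beyond r le = (r ∷ pt r ∷ []) , ((λ e → pt-no-fixpoint r (sym e)) ∷ []) ∷ [] ∷ [] ,
                         (λ j → mk⇔ (sound j) (Star-closed (r ∷ pt r ∷ []) closed (here refl))) , refl
    where
      closed : ∀ {j k} → j ∈ (r ∷ pt r ∷ []) → Edge x j k → k ∈ (r ∷ pt r ∷ [])
      closed (here refl) (inj₁ refl) = there (here refl)
      closed (here refl) (inj₂ refl) = there (here (curved-beyond r le))
      closed (there (here refl)) (inj₁ refl) = here (pt-pt r)
      closed (there (here refl)) (inj₂ refl) = here (trans (cong curved (sym (curved-beyond r le))) (curved-involutive r))
      sound : ∀ j → j ∈ (r ∷ pt r ∷ []) → Connected x r j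
      sound j (here refl) = ε
      sound j (there (here refl)) = inj₁ refl ◅ ε

  -- A witness list of representatives with their
  -- half-sizes is determined by the representatives, which lie below 2n,
  -- so it suffices to search the lists of length l(μ) over [0, 2n).
  module _ (μ : Partition) where

    Sizes Apart Covers Shape Witness : List (ℕ × ℕ) → Set
    Sizes comps = All (λ p → CompSize x (proj₁ p) (2 * proj₂ p) × 2 ≤ proj₂ p) comps
    Apart comps = AllPairs (λ p q → ¬ Connected x (proj₁ p) (proj₁ q)) comps
    Covers comps = ∀ i → ¬ CompSize x i 2 → Any (λ p → Connected x (proj₁ p) i) comps
    Shape comps = map (λ p → proj₂ p ∸ 1) comps ↭ parts μ
    Witness comps = Sizes comps × Apart comps × Covers comps × Shape comps

    -- Covering needs to be checked only below 2n.
    Covers? : ∀ comps → Dec (Covers comps)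
    Covers? comps with all? (λ i → ¬? (CompSize? i 2) →-dec any? (λ p → Connected? (proj₁ p) i) comps) (upTo (2 * n))
    ... | yes below = yes λ i nontrivial → case i <? 2 * n of λ
      { (yes lt) → All.lookup below (∈-upTo⁺ lt) nontrivial
      ; (no ge) → ⊥-elim (nontrivial (CompSize-beyond i (≮⇒≥ ge))) }
    ... | no ¬below = no λ covers → ¬below (All.tabulate λ {i} _ → covers i)

    Witness? : ∀ comps → Dec (Witness comps)
    Witness? comps =
      all? (λ p → CompSize? (proj₁ p) (2 * proj₂ p) ×-dec (2 ≤? proj₂ p)) comps ×-dec
      (allPairs? (λ p q → ¬? (Connected? (proj₁ p) (proj₁ q))) comps ×-dec
      (Covers? comps ×-dec ↭? (map (λ p → proj₂ p ∸ 1) comps) (parts μ)))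

    withHalfSize : ℕ → ℕ × ℕ
    withHalfSize r = r , block (length (component r))

    candidates : List (List (ℕ × ℕ))
    candidates = map (map withHalfSize) (listsOver (len μ) (upTo (2 * n)))

    Sizes-canonical : ∀ comps → Sizes comps →
                      comps ≡ map withHalfSize (map proj₁ comps) × All (_∈ upTo (2 * n)) (map proj₁ comps)
    Sizes-canonical [] [] = refl , []
    Sizes-canonical ((r , s) ∷ comps) ((size , large) ∷ sizes) with Sizes-canonical comps sizes
    ... | canonical , below =
      cong₂ _∷_ (cong (r ,_) (sym (trans (cong block (HasCard-unique (component-size r) size)) (block-double s)))) canonical ,
      ∈-upTo⁺ (≰⇒> λ ge → <⇒≢ large (sym (*-cancelˡ-≡ s 1 2 (HasCard-unique size (CompSize-beyond r ge))))) ∷ below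

    CosetType? : Dec (CosetType x μ)
    CosetType? with any? Witness? candidates
    ... | yes found = yes (Any.satisfied found)
    ... | no none = no λ (comps , witness) → none (candidate comps witness)
      where
        candidate : ∀ comps → Witness comps → Any Witness candidates
        candidate comps witness@(sizes , _ , _ , shape) with Sizes-canonical comps sizes
        ... | canonical , below = lose (subst (_∈ candidates) (sym canonical)
              (∈-map⁺ (map withHalfSize) (subst (λ k → map proj₁ comps ∈ listsOver k (upTo (2 * n))) lengths
                (∈-listsOver (upTo (2 * n)) (map proj₁ comps) below)))) witness
          where
            lengths : length (map proj₁ comps) ≡ len μ
            lengths = trans (length-map proj₁ comps)
                      (trans (sym (length-map (λ p → proj₂ p ∸ 1) comps)) (↭-length shape))

Moved? : ∀ x n → Fix (2 * n) x → ∀ k → Dec (Moved x k)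
Moved? x n fx k = map′ (λ e → support , support-unique , support-members , e)
                       (HasCard-unique (support , support-unique , support-members , refl))
                       (length support ≟ k)
  where
    moves? : ∀ i → Dec (fun x i ≢ i)
    moves? = λ i → ¬? (fun x i ≟ i)
    support : List ℕ
    support = filter moves? (upTo (2 * n))
    support-unique : Unique support
    support-unique = UniqueP.filter⁺ moves? (UniqueP.upTo⁺ (2 * n))
    support-members : ∀ i → i ∈ support ⇔ (fun x i ≢ i)
    support-members i = mk⇔ (λ i∈ → proj₂ (∈-filter⁻ moves? {xs = upTo (2 * n)} i∈))
                            (λ moves → ∈-filter⁺ moves? (∈-upTo⁺ (≰⇒> λ ge → moves (fx i ge))) moves)

Bounded : ℕ → Perm × Perm → Set
Bounded n (x , y) = Fix (2 * n) x × Fix (2 * n) y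

InK? : ∀ μ n x → Fix (2 * n) x → Dec (InK μ x)
InK? μ n x fx = map′ ((n , fx) ,_) proj₂ (Components.CosetType? x n fx μ)

InV? : ∀ μ κ ν n p → Bounded n p → Dec (InV μ κ ν p)
InV? μ κ ν n (x , y) (fx , fy) =
  InK? μ n x fx ×-dec (InK? κ n y fy ×-dec (InK? ν n (x · y) fxy ×-dec Moved? (x · y) n fxy (w ν)))
  where
    fxy : Fix (2 * n) (x · y)
    fxy = Fix-· x y fx fy

-- An explicit finite list of permutations fixing every point ≥ m, which
-- represents each such permutation up to pointwise equality: x = (m x(m)) · x'
-- with x' fixing every point ≥ m - 1.

perms : ℕ → List Perm
perms zero = idP ∷ []
perms (suc m) = cartesianProductWith (λ k e → transposition m k · e) (upTo (suc m)) (perms m)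

perms-Fix : ∀ m {e} → e ∈ perms m → Fix m e
perms-Fix zero (here refl) i _ = refl
perms-Fix (suc m) e∈ with ∈-cartesianProductWith⁻ (λ k e → transposition m k · e) (upTo (suc m)) (perms m) e∈
... | k , e' , k∈ , e'∈ , refl = λ i le →
  trans (cong (swap m k) (perms-Fix m e'∈ i (<⇒≤ le)))
        (swap-other m k i (λ e → <⇒≢ le (sym e)) (λ e → <⇒≢ (≤-<-trans (≤-pred (∈-upTo⁻ k∈)) le) (sym e)))

perms-complete : ∀ m x → Fix m x → ∃[ e ] (e ∈ perms m × (∀ i → fun e i ≡ fun x i))
perms-complete zero x fx = idP , here refl , λ i → sym (fx i z≤n)
perms-complete (suc m) x fx with perms-complete m (transposition m (fun x m) · x) fixes-m
  where
    xm< : fun x m < suc m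
    xm< = Fix-< x fx m ≤-refl
    fixes-m : Fix m (transposition m (fun x m) · x)
    fixes-m i le with m≤n⇒m<n∨m≡n le
    ... | inj₂ refl = swap-right m (fun x m)
    ... | inj₁ lt = trans (cong (swap m (fun x m)) (fx i lt))
          (swap-other m (fun x m) i (λ e → <⇒≢ lt (sym e)) (λ e → <⇒≢ (≤-<-trans (≤-pred xm<) lt) (sym e)))
... | e , e∈ , agrees = transposition m (fun x m) · e ,
  ∈-cartesianProductWith⁺ (λ k e → transposition m k · e) (∈-upTo⁺ (Fix-< x fx m ≤-refl)) e∈ ,
  λ i → trans (cong (swap m (fun x m)) (agrees i)) (swap-involutive m (fun x m) (fun x i))

-- A bad block contains a point of S(x y) or
-- the x-image of a point in a component of Γ_x of size > 2; there are at
-- most w(ν) + 2 w(μ) of these, so among any more blocks one is good.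

GoodBlock : Perm → Perm → ℕ → Set
GoodBlock x y j = fun (x · y) (point j false) ≡ point j false × fun (x · y) (point j true) ≡ point j true
                × pt (inv x (point j false)) ≡ inv x (point j true)

badBound : Partition → Partition → ℕ
badBound μ ν = w ν + 2 * w μ

partners-differ : ∀ x i → pt i ≢ inv x (pt (fun x i)) → ¬ CompSize x i 2
partners-differ x i pt≢curved (L , _ , members , len) = <⇒≱ (≤-reflexive (cong suc len)) (Unique-⊆-length three-distinct three∈L)
  where
    i≢pt : i ≢ pt i
    i≢pt e = pt-no-fixpoint i (sym e)
    i≢curved : i ≢ inv x (pt (fun x i))
    i≢curved e = pt-no-fixpoint (fun x i) (sym (trans (cong (fun x) e) (fun-inv x _)))
    three-distinct : Unique (i ∷ pt i ∷ inv x (pt (fun x i)) ∷ [])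
    three-distinct = (i≢pt ∷ i≢curved ∷ []) ∷ (pt≢curved ∷ []) ∷ [] ∷ []
    three∈L : ∀ k → k ∈ (i ∷ pt i ∷ inv x (pt (fun x i)) ∷ []) → k ∈ L
    three∈L k (here refl) = from (members k) ε
    three∈L k (there (here refl)) = from (members k) (inj₁ refl ◅ ε)
    three∈L k (there (there (here refl))) = from (members k) (inj₂ refl ◅ ε)

module ComponentPoints (x : Perm) where

  points : ∀ comps → All (λ p → CompSize x (proj₁ p) (2 * proj₂ p) × 2 ≤ proj₂ p) comps → List ℕ
  points [] [] = []
  points (p ∷ ps) ((size , _) ∷ sizes) = proj₁ size ++ points ps sizes

  points-length : ∀ comps sizes → length (points comps sizes) ≡ 2 * (sum (map (λ p → proj₂ p ∸ 1) comps) + length comps)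
  points-length [] [] = refl
  points-length ((r , suc s) ∷ ps) (((L , _ , _ , len) , _) ∷ sizes) = begin
      length (L ++ points ps sizes)              ≡⟨ length-++ L ⟩
      length L + length (points ps sizes)        ≡⟨ cong₂ _+_ len (points-length ps sizes) ⟩
      2 * suc s + 2 * (Σparts + length ps)       ≡⟨ sym (*-distribˡ-+ 2 (suc s) (Σparts + length ps)) ⟩
      2 * (suc s + (Σparts + length ps))         ≡⟨ cong (2 *_) (trans (cong suc (sym (+-assoc s Σparts (length ps))))
                                                                     (sym (+-suc (s + Σparts) (length ps)))) ⟩
      2 * (s + Σparts + suc (length ps))         ∎
    where
      open ≡-Reasoning
      Σparts : ℕ
      Σparts = sum (map (λ p → proj₂ p ∸ 1) ps)
  points-length ((r , zero) ∷ ps) ((_ , ()) ∷ sizes)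

  points-cover : ∀ comps sizes {i} → Any (λ p → Connected x (proj₁ p) i) comps → i ∈ points comps sizes
  points-cover (p ∷ ps) (((L , _ , members , _) , _) ∷ sizes) {i} (here path) = ∈-++⁺ˡ (from (members i) path)
  points-cover (p ∷ ps) (((L , _ , _ , _) , _) ∷ sizes) (there covered) = ∈-++⁺ʳ L (points-cover ps sizes covered)

  points-length-w : ∀ μ comps sizes → map (λ p → proj₂ p ∸ 1) comps ↭ parts μ → length (points comps sizes) ≡ 2 * w μ
  points-length-w μ comps sizes shape = trans (points-length comps sizes)
    (cong (2 *_) (trans (cong₂ _+_ (sum-↭ shape) (trans (sym (length-map (λ p → proj₂ p ∸ 1) comps)) (↭-length shape)))
                        (+-comm (size μ) (len μ))))

open ComponentPoints

avoiding-good : ∀ x y (moved nontrivial : List ℕ) → (∀ i → fun (x · y) i ≢ i → i ∈ moved) →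
                (∀ i → ¬ CompSize x i 2 → i ∈ nontrivial) →
                ∀ j → j ∉ map block (moved ++ map (fun x) nontrivial) → GoodBlock x y j
avoiding-good x y moved nontrivial ⊆moved ⊆nontrivial j j∉ = fixed false , fixed true , partners
  where
    bad : ∀ {e} → e ∈ moved ++ map (fun x) nontrivial → block e ≢ j
    bad e∈ refl = j∉ (∈-map⁺ block e∈)
    fixed : ∀ s → fun (x · y) (point j s) ≡ point j s
    fixed s with fun (x · y) (point j s) ≟ point j s
    ... | yes e = e
    ... | no ne = ⊥-elim (bad (∈-++⁺ˡ (⊆moved _ ne)) (block-point j s))
    partners : pt (inv x (point j false)) ≡ inv x (point j true)
    partners with pt (inv x (point j false)) ≟ inv x (point j true)
    ... | yes e = e
    ... | no ne = ⊥-elim (bad (∈-++⁺ʳ moved (subst (_∈ map (fun x) nontrivial) (fun-inv x (point j false))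
                                 (∈-map⁺ (fun x) (⊆nontrivial i nontrivial-i)))) (block-point j false))
      where
        i : ℕ
        i = inv x (point j false)
        nontrivial-i : ¬ CompSize x i 2
        nontrivial-i = partners-differ x i λ e → ne (trans e (cong (inv x)
          (trans (cong pt (fun-inv x (point j false))) (pt-point-false j))))

goodBlock-exists : ∀ μ κ ν M x y → InV μ κ ν (x , y) → badBound μ ν ≤ M → ∃[ j ] (j ≤ M × GoodBlock x y j)
goodBlock-exists μ κ ν M x y ((_ , comps , sizes , _ , cover , shape) , _ , _ , (moved , _ , movedMembers , movedLength)) N≤M =
  let j , j≤M , j∉bad = missing M (map block bad) (subst (_≤ M) (sym badCount) N≤M)
  in j , j≤M , avoiding-good x y moved nontrivial (λ i → from (movedMembers i))
                 (λ i nontrivial-i → points-cover x comps sizes (cover i nontrivial-i)) j j∉bad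
  where
    nontrivial : List ℕ
    nontrivial = points x comps sizes
    bad : List ℕ
    bad = moved ++ map (fun x) nontrivial
    badCount : length (map block bad) ≡ badBound μ ν
    badCount = begin
      length (map block bad)                          ≡⟨ length-map block bad ⟩
      length bad                                      ≡⟨ length-++ moved ⟩
      length moved + length (map (fun x) nontrivial)  ≡⟨ cong₂ _+_ movedLength (length-map (fun x) nontrivial) ⟩
      w ν + length nontrivial                         ≡⟨ cong (w ν +_) (points-length-w x μ comps sizes shape) ⟩
      w ν + 2 * w μ                                   ∎
      where open ≡-Reasoning

-- Conjugating by an element of B∞ moves a good block to
-- block M; then translating by one more element of B∞ makes both x and y
-- fix block M.

Bounded-mono : ∀ m n p → m ≤ n → Bounded m p → Bounded n p
Bounded-mono m n (x , y) le (fx , fy) = Fix-mono x (*-monoʳ-≤ 2 {m} {n} le) fx , Fix-mono y (*-monoʳ-≤ 2 {m} {n} le) fy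

inv-point-true : ∀ a u M → CommutesPt a → fun a u ≡ point M false → inv a (point M true) ≡ pt u
inv-point-true a u M ca au = begin
  inv a (point M true)        ≡⟨ cong (inv a) (sym (pt-point-false M)) ⟩
  inv a (pt (point M false))  ≡⟨ CommutesPt-inv a ca (point M false) ⟩
  pt (inv a (point M false))  ≡⟨ cong pt (inv-unique a au) ⟩
  pt u                        ∎
  where open ≡-Reasoning

conjugate-good : ∀ a x y j M → CommutesPt a → fun a (point j false) ≡ point M false →
                 GoodBlock x y j → GoodBlock (a · (x · invP a)) (a · (y · invP a)) M
conjugate-good a x y j M ca a2j (xy-fixes-false , xy-fixes-true , partners) =
  fixes false xy-fixes-false , fixes true xy-fixes-true , partners'
  where
    back : ∀ s → inv a (point M s) ≡ point j s
    back false = inv-unique a a2j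
    back true = trans (inv-point-true a (point j false) M ca a2j) (pt-point-false j)
    fixes : ∀ s → fun (x · y) (point j s) ≡ point j s →
            fun a (fun x (inv a (fun a (fun y (inv a (point M s)))))) ≡ point M s
    fixes s xy-fixes = begin
      fun a (fun x (inv a (fun a (fun y (inv a (point M s))))))  ≡⟨ cong (fun a ∘ fun x) (inv-fun a _) ⟩
      fun a (fun (x · y) (inv a (point M s)))                      ≡⟨ cong (fun a ∘ fun (x · y)) (back s) ⟩
      fun a (fun (x · y) (point j s))                              ≡⟨ cong (fun a) xy-fixes ⟩
      fun a (point j s)                                            ≡⟨ cong (fun a) (sym (back s)) ⟩
      fun a (inv a (point M s))                                    ≡⟨ fun-inv a _ ⟩
      point M s                                                    ∎
      where open ≡-Reasoning
    partners' : pt (fun a (inv x (inv a (point M false)))) ≡ fun a (inv x (inv a (point M true)))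
    partners' = begin
      pt (fun a (inv x (inv a (point M false))))  ≡⟨ sym (ca _) ⟩
      fun a (pt (inv x (inv a (point M false))))  ≡⟨ cong (fun a ∘ pt ∘ inv x) (back false) ⟩
      fun a (pt (inv x (point j false)))          ≡⟨ cong (fun a) partners ⟩
      fun a (inv x (point j true))                ≡⟨ cong (fun a ∘ inv x) (sym (back true)) ⟩
      fun a (inv x (inv a (point M true)))        ∎
      where open ≡-Reasoning

Fix-from-block : ∀ M x → fun x (point M false) ≡ point M false → fun x (point M true) ≡ point M true →
                 Fix (2 * suc M) x → Fix (2 * M) x
Fix-from-block M x fixes-false fixes-true fixes-beyond i le with ≥-block-or-beyond M i le
... | inj₁ refl = fixes-false
... | inj₂ (inj₁ refl) = fixes-true
... | inj₂ (inj₂ ge) = fixes-beyond i ge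

shrinker : ℕ → Perm → Perm
shrinker M x = moveTo (inv x (point M false)) (point M false)

shrinker-Fix : ∀ M x → Fix (2 * suc M) x → Fix (2 * suc M) (shrinker M x)
shrinker-Fix M x fx = Fix-mono (shrinker M x) (*-monoʳ-≤ 2 (s≤s (⊔-lub block-k≤M (≤-reflexive (block-point M false)))))
                               (moveTo-Fix k (point M false))
  where
    k : ℕ
    k = inv x (point M false)
    k< : k < 2 * suc M
    k< = Fix-< (invP x) (Fix-inv x fx) (point M false)
           (subst (_< 2 * suc M) (sym (point-false M)) (*-monoʳ-< 2 (n<1+n M)))
    block-k≤M : block k ≤ M
    block-k≤M = ≤-pred (≰⇒> λ ge → <⇒≱ k< (block-≥⇒≥ (suc M) k ge))

shrink : ∀ M x y → Bounded (suc M) (x , y) → GoodBlock x y M →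
         Bounded M (x · invP (shrinker M x) , shrinker M x · y)
shrink M x y (fx , fy) (xy-fixes-false , xy-fixes-true , partners) =
  Fix-from-block M (x · invP β)
    (trans (cong (fun x) (inv-unique β βk)) (fun-inv x (point M false)))
    (trans (cong (fun x) (trans (inv-point-true β k M βcommutes βk) partners)) (fun-inv x (point M true)))
    (Fix-· x (invP β) fx (Fix-inv β βFix)) ,
  Fix-from-block M (β · y)
    (trans (cong (fun β) (sym (inv-unique x xy-fixes-false))) βk)
    (trans (cong (fun β) (trans (sym (inv-unique x xy-fixes-true)) (sym partners)))
           (trans (βcommutes k) (trans (cong pt βk) (pt-point-false M))))
    (Fix-· β y βFix fy)
  where
    β = shrinker M x
    k : ℕ
    k = inv x (point M false)
    βk : fun β k ≡ point M false
    βk = moveTo-sends k (point M false)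
    βcommutes : CommutesPt β
    βcommutes = moveTo-commutes k (point M false)
    βFix : Fix (2 * suc M) β
    βFix = shrinker-Fix M x fx

compress-step : ∀ μ κ ν M x y → InV μ κ ν (x , y) → badBound μ ν ≤ M → Bounded (suc M) (x , y) →
                ∃[ q ] (Bounded M q × InOrbit (x , y) q)
compress-step μ κ ν M x y v N≤M (fx , fy) with goodBlock-exists μ κ ν M x y v N≤M
... | j , j≤M , good = (x₂ , y₂) , shrink M x₁ y₁ bounded₁ good₁ , InOrbit-trans {x , y} {x₁ , y₁} {x₂ , y₂} orbit₁ orbit₂
  where
    a : Perm
    a = moveTo (point j false) (point M false)
    x₁ y₁ : Perm
    x₁ = a · (x · invP a)
    y₁ = a · (y · invP a)
    a∈B∞ : InB∞ a
    a∈B∞ = moveTo-B∞ (point j false) (point M false)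
    aFix : Fix (2 * suc M) a
    aFix = Fix-mono a (*-monoʳ-≤ 2 (s≤s (subst₂ (λ b c → b ⊔ c ≤ M) (sym (block-point j false)) (sym (block-point M false))
                                                 (⊔-lub j≤M ≤-refl))))
                      (moveTo-Fix (point j false) (point M false))
    orbit₁ : InOrbit (x , y) (x₁ , y₁)
    orbit₁ = a , a , a∈B∞ , a∈B∞ , (λ _ → refl) , (λ _ → refl)
    bounded₁ : Bounded (suc M) (x₁ , y₁)
    bounded₁ = Translate-Fix {a} {a} {x} {x₁} (λ _ → refl) aFix fx aFix , Translate-Fix {a} {a} {y} {y₁} (λ _ → refl) aFix fy aFix
    good₁ : GoodBlock x₁ y₁ M
    good₁ = conjugate-good a x y j M (moveTo-commutes (point j false) (point M false)) (moveTo-sends (point j false) (point M false)) good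
    β : Perm
    β = shrinker M x₁
    x₂ y₂ : Perm
    x₂ = x₁ · invP β
    y₂ = β · y₁
    orbit₂ : InOrbit (x₁ , y₁) (x₂ , y₂)
    orbit₂ = idP , β , B∞-id , moveTo-B∞ (inv x₁ (point M false)) (point M false) , (λ _ → refl) , (λ _ → refl)

compress : ∀ μ κ ν M x y → InV μ κ ν (x , y) → Bounded M (x , y) →
           ∃[ q ] (Bounded (badBound μ ν) q × InOrbit (x , y) q)
compress μ κ ν zero x y v b = (x , y) , Bounded-mono 0 (badBound μ ν) (x , y) z≤n b , InOrbit-refl (x , y)
compress μ κ ν (suc M) x y v b = stopOrShrink (suc M ≤? badBound μ ν)
  where
    Goal : Set
    Goal = ∃[ q ] (Bounded (badBound μ ν) q × InOrbit (x , y) q)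
    continue : ∃[ q ] (Bounded M q × InOrbit (x , y) q) → Goal
    continue ((x₁ , y₁) , b₁ , o₁) =
      let q , bq , o = compress μ κ ν M x₁ y₁ (InV-transport μ κ ν {x , y} {x₁ , y₁} o₁ v) b₁
      in q , bq , InOrbit-trans {x , y} {x₁ , y₁} {q} o₁ o
    stopOrShrink : Dec (suc M ≤ badBound μ ν) → Goal
    stopOrShrink (yes le) = (x , y) , Bounded-mono (suc M) (badBound μ ν) (x , y) le b , InOrbit-refl (x , y)
    stopOrShrink (no gt) = continue (compress-step μ κ ν M x y v (≤-pred (≰⇒> gt)) b)

-- The finitely many pairs in S_{2N} × S_{2N}, up to pointwise equality.
boundedPairs : ℕ → List (Perm × Perm)
boundedPairs N = cartesianProduct (perms (2 * N)) (perms (2 * N))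

boundedPairs-Bounded : ∀ N → All (Bounded N) (boundedPairs N)
boundedPairs-Bounded N = All.tabulate λ {(x , y)} p∈ → let x∈ , y∈ = ∈-cartesianProduct⁻ (perms (2 * N)) (perms (2 * N)) p∈ in
  perms-Fix (2 * N) x∈ , perms-Fix (2 * N) y∈

boundedPairs-complete : ∀ N q → Bounded N q → ∃[ e ] (e ∈ boundedPairs N × InOrbit e q)
boundedPairs-complete N (x , y) (fx , fy) with perms-complete (2 * N) x fx | perms-complete (2 * N) y fy
... | ex , ex∈ , ex≗x | ey , ey∈ , ey≗y =
  (ex , ey) , ∈-cartesianProduct⁺ ex∈ ey∈ , idP , idP , B∞-id , B∞-id , (λ i → sym (ex≗x i)) , (λ i → sym (ey≗y i))

InS2∞-Bounded : ∀ x y → InS2∞ x → InS2∞ y → ∃[ M ] Bounded M (x , y)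
InS2∞-Bounded x y (nx , fx) (ny , fy) =
  nx ⊔ ny , Fix-mono x (*-monoʳ-≤ 2 {nx} {nx ⊔ ny} (m≤m⊔n nx ny)) fx , Fix-mono y (*-monoʳ-≤ 2 {ny} {nx ⊔ ny} (m≤n⊔m nx ny)) fy

representative : ∀ μ κ ν q → InV μ κ ν q → ∃[ e ] (e ∈ boundedPairs (badBound μ ν) × InV μ κ ν e × InOrbit e q)
representative μ κ ν (x , y) v with InS2∞-Bounded x y (proj₁ (proj₁ v)) (proj₁ (proj₁ (proj₂ v)))
... | M , bounded with compress μ κ ν M x y v bounded
...   | q , bq , q-orbit with boundedPairs-complete (badBound μ ν) q bq
...     | e , e∈ , e-orbit = e , e∈ , InV-transport μ κ ν {x , y} {e} (InOrbit-sym {e} {x , y} e→xy) v , e→xy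
  where
    e→xy : InOrbit e (x , y)
    e→xy = InOrbit-trans {e} {q} {x , y} e-orbit (InOrbit-sym {x , y} {q} q-orbit)

orbits-cover-V : ∀ μ κ ν (L : List (Perm × Perm)) → (∀ {e} → e ∈ boundedPairs (badBound μ ν) → InV μ κ ν e → e ∈ L) →
                 ∀ q → InV μ κ ν q → Any (λ p → InOrbit p q) L
orbits-cover-V μ κ ν L complete q v =
  let e , e∈ , ve , orbit = representative μ κ ν q v in lose (complete e∈ ve) orbit

orbits-in-V : ∀ μ κ ν (L : List (Perm × Perm)) → (∀ {p} → p ∈ L → InV μ κ ν p) →
              ∀ q → Any (λ p → InOrbit p q) L → InV μ κ ν q
orbits-in-V μ κ ν L sound q found =
  let p , p∈ , orbit = find found in InV-transport μ κ ν {p} {q} orbit (sound p∈)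

corollary4p4 : (μ κ ν : Partition) → FiniteUnionOfOrbits (InV μ κ ν)
corollary4p4 μ κ ν =
  basePoints , All.tabulate inS2∞ ,
  λ q → mk⇔ (orbits-cover-V μ κ ν basePoints (filterWith-complete pairs bounded) q)
            (orbits-in-V μ κ ν basePoints (λ p∈ → proj₁ (filterWith-sound pairs bounded p∈)) q)
  where
    N : ℕ
    N = badBound μ ν
    pairs : List (Perm × Perm)
    pairs = boundedPairs N
    bounded : All (Bounded N) pairs
    bounded = boundedPairs-Bounded N
    open FilterWith (Bounded N) (InV μ κ ν) (InV? μ κ ν N)
    basePoints : List (Perm × Perm)
    basePoints = filterWith pairs bounded
    inS2∞ : ∀ {p} → p ∈ basePoints → InS2∞ (proj₁ p) × InS2∞ (proj₂ p)
    inS2∞ {x , y} p∈ with filterWith-sound pairs bounded p∈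
    ... | _ , fx , fy = (N , fx) , (N , fy)
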